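{- For every formula $\varphi$ of $\mathcal{I}$ and every SD-model $W$: $W\Vdash\varphi$ iff $W\models t_{\chi(\varphi)}(\varphi)$.
   Context: Fix a countably infinite set $\mathit{PROP}$ of proposition symbols; assignments are maps $w:\mathit{PROP}\to\{0,1\}$; an SD-model is a (possibly empty) set $W$ of assignments. $\mathcal{I}$: formulae $\varphi::=p\mid\neg p\mid(p_1,\dots,p_k)\,\mathsf{I}_{(r_1,\dots,r_m)}(q_1,\dots,q_n)\mid(\varphi\vee\varphi)\mid(\varphi\wedge\varphi)$ (symbols in $\mathit{PROP}$, $k,n\ge1$, $m\ge0$). Team semantics: $W\Vdash p$ iff $w(p)=1$ for all $w\in W$; $W\Vdash\neg p$ iff $w(p)=0$ for all $w\in W$; $W\Vdash(p_1,\dots,p_k)\,\mathsf{I}_{(r_1,\dots,r_m)}(q_1,\dots,q_n)$ iff for all $w_1,w_2\in W$ agreeing on all $r_i$ there is $v\in W$ agreeing with $w_1$ on all $r_i$ and $p_i$ and with $w_2$ on all $q_i$; $W\Vdash\varphi\wedge\psi$ iff both; $W\Vdash\varphi\vee\psi$ iff $W=U\cup V$ for some $U,V\subseteq W$ with $U\Vdash\varphi$, $V\Vdash\psi$. $\mathcal{L}_{\mathsf{D}}$: formulae $\varphi::=p\mid\neg\varphi\mid(\varphi\to\varphi)\mid\mathsf{D}(\varphi_1,\dots,\varphi_k;\psi)$ ($k\in\mathbb{N}$; $\mathsf{C}\psi$ for $k=0$); $W,w\models p$ iff $w(p)=1$; $\neg,\to$ classical; $W,w\models\mathsf{D}(\varphi_1,\dots,\varphi_k;\psi)$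 iff all $u,v\in W$ agreeing on the truth of each $\varphi_i$ agree on the truth of $\psi$. $W\models\varphi$ means $W,w\models\varphi$ for all $w\in W$. $[\mathsf{u}]\varphi:=\varphi\wedge\mathsf{C}\varphi$, $\langle\mathsf{u}\rangle\varphi:=\neg[\mathsf{u}]\neg\varphi$; $\top:=p\vee\neg p$, $\bot:=p\wedge\neg p$. Types: for a finite nonempty set $\Phi$ of formulae, $\mathit{Conj}(\Phi)$ is the set of conjunctions containing each member of $\Phi$ exactly once, either positively or negated; $\mathit{Conj}(\emptyset)=\{\top\}$; $\mathit{DNF}(\Phi)=\{\bigvee U:U\subseteq\mathit{Conj}(\Phi)\}$ with $\bigvee\emptyset=\bot$. For $\chi=\bigvee\{\chi_1,\dots,\chi_k\}\in\mathit{DNF}(\Phi)$ with $\Phi$ a finite nonempty set of proposition symbols, $\mathit{SPLIT}(\chi)$ is the set of pairs $(\alpha,\beta)$ with $\alpha=\bigvee\{\alpha_1,\dots,\alpha_m\}$, $\beta=\bigvee\{\beta_1,\dots,\beta_n\}$ in $\mathit{DNF}(\Phi)$ such that $\{\chi_1,\dots,\chi_k\}=\{\alpha_1,\dots,\alpha_m\}\cup\{\beta_1,\dots,\beta_n\}$. Translation: for a formula $\varphi$ of $\mathcal{I}$ let $\Phi$ be the set of proposition symbols in $\varphi$; for $\chi\in\mathit{DNF}(\Phi)$ define $t_\chi$ on subformulae of $\varphi$ by: $t_\chi(p)=[\mathsf{u}](\chi\to p)$; $t_\chi(\neg p)=[\mathsf{u}](\chi\to\neg p)$; $t_\chi((p_1,\dots,p_k)\,\mathsf{I}_{(q_1,\dots,q_m)}(r_1,\dots,r_n))=\bigwedge_{(\varphi',\psi',\theta')\in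 B}\big((\langle\mathsf{u}\rangle(\chi\wedge\psi'\wedge\varphi')\wedge\langle\mathsf{u}\rangle(\chi\wedge\psi'\wedge\theta'))\to\langle\mathsf{u}\rangle(\chi\wedge\psi'\wedge\varphi'\wedge\theta')\big)$ where $B=\mathit{Conj}(\{p_1,\dots,p_k\})\times\mathit{Conj}(\{q_1,\dots,q_m\})\times\mathit{Conj}(\{r_1,\dots,r_n\})$; $t_\chi(\psi\wedge\psi')=t_\chi(\psi)\wedge t_\chi(\psi')$; $t_\chi(\psi\vee\psi')=\bigvee_{(\alpha,\beta)\in\mathit{SPLIT}(\chi)}(t_\alpha(\psi)\wedge t_\beta(\psi'))$. Finally $\chi(\varphi)\in\mathit{DNF}(\Phi)$ is the disjunction of all types in $\mathit{Conj}(\Phi)$. -}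

module Defs where

open import Level using (Lift; 0ℓ) renaming (suc to lsuc)
open import Data.Nat using (ℕ; _≟_)
open import Data.Bool using (Bool; true; false)
open import Data.List using (List; []; _∷_; [_]; map; concatMap; _++_; deduplicate; length; replicate)
open import Data.List.NonEmpty using (List⁺; toList)
open import Data.List.Relation.Unary.All using (All)
open import Data.Product using (Σ; _×_; _,_)
open import Data.Sum using (_⊎_)
open import Relation.Binary.PropositionalEquality using (_≡_)
open import Relation.Nullary using (¬_)
open import Function.Bundles using (_⇔_)

PROP : Set
PROP = ℕ

Assignment : Set
Assignment = PROP → Bool

-- An SD-model is an arbitrary (possibly empty, possibly infinite) set of
-- assignments, represented as a predicate on assignments.
SDModel : Set₁
SDModel = Assignment → Set

-- indep xs ys zs  is  (x₁,…,x_k) I_(y₁,…,y_m) (z₁,…,z_n),  k,n ≥ 1, m ≥ 0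
data IForm : Set where
  atom  : PROP → IForm
  natom : PROP → IForm
  indep : List⁺ PROP → List PROP → List⁺ PROP → IForm
  _∨ᴵ_  : IForm → IForm → IForm
  _∧ᴵ_  : IForm → IForm → IForm

AgreeOn : List PROP → Assignment → Assignment → Set
AgreeOn ps w v = All (λ p → w p ≡ v p) ps

infix 4 _⊩_
_⊩_ : SDModel → IForm → Set₁
W ⊩ atom p  = Lift (lsuc 0ℓ) (∀ w → W w → w p ≡ true)
W ⊩ natom p = Lift (lsuc 0ℓ) (∀ w → W w → w p ≡ false)
W ⊩ indep xs ys zs = Lift (lsuc 0ℓ)
  (∀ w₁ w₂ → W w₁ → W w₂ → AgreeOn ys w₁ w₂ →
     Σ Assignment λ v → W v × AgreeOn ys v w₁ × AgreeOn (toList xs) v w₁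
                            × AgreeOn (toList zs) v w₂)
W ⊩ (φ ∧ᴵ ψ) = (W ⊩ φ) × (W ⊩ ψ)
W ⊩ (φ ∨ᴵ ψ) = Σ SDModel λ U → Σ SDModel λ V →
  (∀ w → W w ⇔ (U w ⊎ V w)) × (U ⊩ φ) × (V ⊩ ψ)

data DForm : Set where
  var : PROP → DForm
  neg : DForm → DForm
  _⇒_ : DForm → DForm → DForm
  D   : List DForm → DForm → DForm

infixr 5 _⇒_

C : DForm → DForm
C ψ = D [] ψ

_∧ᴰ_ : DForm → DForm → DForm
φ ∧ᴰ ψ = neg (φ ⇒ neg ψ)

_∨ᴰ_ : DForm → DForm → DForm
φ ∨ᴰ ψ = neg φ ⇒ ψ

⊤ᴰ : DForm
⊤ᴰ = var 0 ∨ᴰ neg (var 0)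

⊥ᴰ : DForm
⊥ᴰ = var 0 ∧ᴰ neg (var 0)

[u]_ : DForm → DForm
[u] φ = φ ∧ᴰ C φ

⟨u⟩_ : DForm → DForm
⟨u⟩ φ = neg ([u] (neg φ))

mutual
  Sat : SDModel → Assignment → DForm → Set
  Sat W w (var p)   = w p ≡ true
  Sat W w (neg φ)   = ¬ Sat W w φ
  Sat W w (φ ⇒ ψ)   = Sat W w φ → Sat W w ψ
  Sat W w (D φs ψ)  = ∀ u v → W u → W v → AgreeAll W u v φs →
                        (Sat W u ψ ⇔ Sat W v ψ)

  AgreeAll : SDModel → Assignment → Assignment → List DForm → Set
  AgreeAll W u v []       = Lift 0ℓ (0 ≡ 0)
  AgreeAll W u v (φ ∷ φs) = (Sat W u φ ⇔ Sat W v φ) × AgreeAll W u v φs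

infix 4 _⊨_
_⊨_ : SDModel → DForm → Set
W ⊨ φ = ∀ w → W w → Sat W w φ

⋀ : List DForm → DForm
⋀ []           = ⊤ᴰ
⋀ (x ∷ [])     = x
⋀ (x ∷ y ∷ xs) = x ∧ᴰ ⋀ (y ∷ xs)

⋁ : List DForm → DForm
⋁ []           = ⊥ᴰ
⋁ (x ∷ [])     = x
⋁ (x ∷ y ∷ xs) = x ∨ᴰ ⋁ (y ∷ xs)

literalChoices : List PROP → List (List DForm)
literalChoices []       = [ [] ]
literalChoices (p ∷ ps) =
  concatMap (λ ls → (var p ∷ ls) ∷ (neg (var p) ∷ ls) ∷ []) (literalChoices ps)

dedup : List PROP → List PROP
dedup = deduplicate _≟_

Conj : List PROP → List DForm
Conj ps = map ⋀ (literalChoices (dedup ps))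

-- An element of DNF(Φ) is given by a subset of Conj(Φ), encoded as a
-- membership mask (Bool list) along the list Conj(Φ).
Mask : Set
Mask = List Bool

select : Mask → List DForm → List DForm
select (true ∷ m)  (c ∷ cs) = c ∷ select m cs
select (false ∷ m) (c ∷ cs) = select m cs
select _           _        = []

dnf : List DForm → Mask → DForm
dnf cs χ = ⋁ (select χ cs)

-- SPLIT(χ): all pairs (α , β) of subsets with α ∪ β = χ
SPLIT : Mask → List (Mask × Mask)
SPLIT []          = [ ([] , []) ]
SPLIT (false ∷ m) = map (λ { (a , b) → (false ∷ a , false ∷ b) }) (SPLIT m)
SPLIT (true ∷ m)  = concatMap (λ { (a , b) →
      (true ∷ a , false ∷ b) ∷ (false ∷ a , true ∷ b) ∷ (true ∷ a , true ∷ b) ∷ [] })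
  (SPLIT m)

props : IForm → List PROP
props (atom p)         = [ p ]
props (natom p)        = [ p ]
props (indep xs ys zs) = toList xs ++ ys ++ toList zs
props (φ ∨ᴵ ψ)         = props φ ++ props ψ
props (φ ∧ᴵ ψ)         = props φ ++ props ψ

-- t χ over the fixed type list cs = Conj(Φ)
t : List DForm → Mask → IForm → DForm
t cs χ (atom p)  = [u] (dnf cs χ ⇒ var p)
t cs χ (natom p) = [u] (dnf cs χ ⇒ neg (var p))
t cs χ (indep xs ys zs) =
  ⋀ (concatMap (λ φ' → concatMap (λ ψ' → map (λ θ' →
       ((⟨u⟩ (χf ∧ᴰ (ψ' ∧ᴰ φ'))) ∧ᴰ (⟨u⟩ (χf ∧ᴰ (ψ' ∧ᴰ θ'))))
         ⇒ ⟨u⟩ (χf ∧ᴰ (ψ' ∧ᴰ (φ' ∧ᴰ θ'))))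
     (Conj (toList zs))) (Conj ys)) (Conj (toList xs)))
  where χf = dnf cs χ
t cs χ (φ ∧ᴵ ψ) = t cs χ φ ∧ᴰ t cs χ ψ
t cs χ (φ ∨ᴵ ψ) = ⋁ (map (λ { (α , β) → t cs α φ ∧ᴰ t cs β ψ }) (SPLIT χ))

-- Φ, and χ(φ) = disjunction of all types in Conj(Φ)
Φ-types : IForm → List DForm
Φ-types φ = Conj (props φ)

χ-full : IForm → Mask
χ-full φ = replicate (length (Φ-types φ)) true

translate : IForm → DForm
translate φ = t (Φ-types φ) (χ-full φ) φ

-- Relative to the symbols Φ of φ, all a formula of I sees of an assignment is its type,
-- the conjunction of Φ-literals it satisfies, so team satisfaction transfers between teams
-- realising the same types. An element χ of DNF(Φ) selects types, hence the subteam of W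
-- of assignments of those types, and t_χ(ψ) holds (at any point of W) iff that subteam
-- satisfies ψ. For an independence atom this says that whenever the type combinations
-- b∧a and b∧c are realised, so is b∧a∧c; for a disjunction, a cover U ∪ V of the subteam
-- induces the split (α, β) of χ recording which types U and V realise, and U, V may be
-- replaced by the subteams of α and β. For χ(φ) the subteam is all of W. Excluded middle
-- is needed to read the classical connectives of L_D.
module Submission where

open import Defs
open import Level using (0ℓ; lift)
open import Axiom.ExcludedMiddle using (ExcludedMiddle)
open import Function.Base using (id; _∘_; case_of_)
open import Function.Construct.Composition using (_⇔-∘_)
open import Function.Construct.Symmetry using (⇔-sym)
open import Function.Bundles using (_⇔_; mk⇔; Equivalence)
open import Data.Bool using (Bool; true; false)
open import Data.Bool.Properties using (¬-not; not-¬)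
open import Data.List using (List; []; _∷_; _++_; map; concatMap; length; replicate)
open import Data.List.NonEmpty using (List⁺; toList)
open import Data.List.Relation.Unary.All as All using (All; []; _∷_)
open import Data.List.Relation.Unary.All.Properties using (anti-mono)
open import Data.List.Relation.Unary.Any as Any using (Any; here; there)
import Data.List.Relation.Unary.Any.Properties as Any
open import Data.List.Membership.Propositional using (_∈_; find; lose)
open import Data.List.Membership.Propositional.Properties
  using (∈-map⁺; ∈-map⁻; ∈-concatMap⁺; ∈-concatMap⁻; ∈-deduplicate⁺; ∈-deduplicate⁻)
open import Data.List.Relation.Binary.Subset.Propositional using (_⊆_)
open import Data.List.Relation.Binary.Subset.Propositional.Properties
  using (xs⊆xs++ys; xs⊆ys++xs)
open import Data.Nat using (_≟_)
open import Data.Product using (∃; ∃₂; ∃-syntax; _×_; _,_; proj₁; uncurry)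
open import Data.Product.Function.NonDependent.Propositional using (_×-⇔_)
open import Data.Sum using (_⊎_; inj₁; inj₂; [_,_]; [_,_]′)
import Data.Sum as Sum
open import Data.Empty using (⊥; ⊥-elim)
open import Relation.Nullary using (¬_; yes; no)
open import Relation.Nullary.Decidable using (decidable-stable; toSum)
open import Relation.Binary.PropositionalEquality using (_≡_; refl; sym; trans; subst)

open Equivalence using (to; from)

private
  variable
    p : PROP
    ps : List PROP
    c : DForm
    ls cs′ : List DForm
    a b : Bool
    χ α β : Mask
    u v : Assignment
    T T′ : SDModel

agree-refl : AgreeOn ps u u
agree-refl = All.tabulate (λ _ → refl)

agree-sym : AgreeOn ps u v → AgreeOn ps v u
agree-sym = All.map sym

agree-trans : ∀ {w} → AgreeOn ps u v → AgreeOn ps v w → AgreeOn ps u w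
agree-trans uv vw = All.zipWith (uncurry trans) (uv , vw)

agree-through : ∀ {qs u₁ u₂ v₁ v₂} → qs ⊆ ps → AgreeOn ps u₁ v₁ → AgreeOn qs v₁ v₂ →
                AgreeOn ps v₂ u₂ → AgreeOn qs u₁ u₂
agree-through qs⊆ps u₁v₁ v₁v₂ v₂u₂ =
  agree-trans (anti-mono qs⊆ps u₁v₁) (agree-trans v₁v₂ (anti-mono qs⊆ps v₂u₂))

_≲[_]_ : SDModel → List PROP → SDModel → Set
T ≲[ ps ] T′ = ∀ u → T u → ∃[ v ] (T′ v × AgreeOn ps u v)

≲-reflexive : (∀ v → T v → T′ v) → T ≲[ ps ] T′
≲-reflexive T⊆T′ u Tu = u , T⊆T′ u Tu , agree-refl

⊩-transfer : ∀ ψ → props ψ ⊆ ps → T ≲[ ps ] T′ → T′ ≲[ ps ] T → T ⊩ ψ → T′ ⊩ ψ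
⊩-transfer (atom p) sub _ back (lift h) = lift λ w T′w →
  let u , Tu , w~u = back w T′w in trans (All.lookup w~u (sub (here refl))) (h u Tu)
⊩-transfer (natom p) sub _ back (lift h) = lift λ w T′w →
  let u , Tu , w~u = back w T′w in trans (All.lookup w~u (sub (here refl))) (h u Tu)
⊩-transfer {ps} (indep xs ys zs) sub forth back (lift h) = lift λ w₁ w₂ T′w₁ T′w₂ w₁~w₂ →
  let u₁ , Tu₁ , w₁~u₁ = back w₁ T′w₁
      u₂ , Tu₂ , w₂~u₂ = back w₂ T′w₂
      v , Tv , v~ys , v~xs , v~zs = h u₁ u₂ Tu₁ Tu₂ (agree-through ys⊆ (agree-sym w₁~u₁) w₁~w₂ w₂~u₂)
      v′ , T′v′ , v~v′ = forth v Tv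
  in v′ , T′v′ , agree-through ys⊆ (agree-sym v~v′) v~ys (agree-sym w₁~u₁)
        , agree-through xs⊆ (agree-sym v~v′) v~xs (agree-sym w₁~u₁)
        , agree-through zs⊆ (agree-sym v~v′) v~zs (agree-sym w₂~u₂)
  where
  xs⊆ : toList xs ⊆ ps
  xs⊆ = sub ∘ xs⊆xs++ys (toList xs) (ys ++ toList zs)
  ys⊆ : ys ⊆ ps
  ys⊆ = sub ∘ xs⊆ys++xs (ys ++ toList zs) (toList xs) ∘ xs⊆xs++ys ys (toList zs)
  zs⊆ : toList zs ⊆ ps
  zs⊆ = sub ∘ xs⊆ys++xs (ys ++ toList zs) (toList xs) ∘ xs⊆ys++xs (toList zs) ys
⊩-transfer (ψ ∧ᴵ ψ′) sub forth back (h , h′) =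
  ⊩-transfer ψ (sub ∘ xs⊆xs++ys _ _) forth back h ,
  ⊩-transfer ψ′ (sub ∘ xs⊆ys++xs _ (props ψ)) forth back h′
⊩-transfer {ps} {T} {T′} (ψ ∨ᴵ ψ′) sub forth back (U , V , cover , hU , hV) =
  Twins U , Twins V , cover′ ,
  ⊩-transfer ψ (sub ∘ xs⊆xs++ys _ _) (into inj₁) outof hU ,
  ⊩-transfer ψ′ (sub ∘ xs⊆ys++xs _ (props ψ)) (into inj₂) outof hV
  where
  Twins : SDModel → SDModel
  Twins X w = T′ w × ∃[ u ] (X u × AgreeOn ps u w)

  into : ∀ {X} → (∀ {u} → X u → U u ⊎ V u) → X ≲[ ps ] Twins X
  into inX u Xu = let v , T′v , u~v = forth u (from (cover u) (inX Xu)) in v , (T′v , u , Xu , u~v) , u~v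

  outof : ∀ {X} → Twins X ≲[ ps ] X
  outof w (_ , u , Xu , u~w) = u , Xu , agree-sym u~w

  cover′ : ∀ w → T′ w ⇔ (Twins U w ⊎ Twins V w)
  cover′ w = mk⇔ split [ proj₁ , proj₁ ]
    where
    split : T′ w → Twins U w ⊎ Twins V w
    split T′w = let u , Tu , w~u = back w T′w in
      Sum.map (λ Uu → T′w , u , Uu , agree-sym w~u) (λ Vu → T′w , u , Vu , agree-sym w~u)
              (to (cover u) Tu)

⊩-empty : ∀ ψ → (∀ w → ¬ T w) → T ⊩ ψ
⊩-empty (atom p) T≡∅ = lift λ w Tw → ⊥-elim (T≡∅ w Tw)
⊩-empty (natom p) T≡∅ = lift λ w Tw → ⊥-elim (T≡∅ w Tw)
⊩-empty (indep xs ys zs) T≡∅ = lift λ w₁ _ Tw₁ _ _ → ⊥-elim (T≡∅ w₁ Tw₁)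
⊩-empty (ψ ∧ᴵ ψ′) T≡∅ = ⊩-empty ψ T≡∅ , ⊩-empty ψ′ T≡∅
⊩-empty {T} (ψ ∨ᴵ ψ′) T≡∅ =
  T , T , (λ w → mk⇔ inj₁ [ id , id ]) , ⊩-empty ψ T≡∅ , ⊩-empty ψ′ T≡∅

All-concatMap³ : ∀ {A B C D : Set} {P : D → Set} (g : A → B → C → D) xs ys zs →
                 All P (concatMap (λ x → concatMap (λ y → map (λ z → g x y z) zs) ys) xs)
                 ⇔ (∀ {x y z} → x ∈ xs → y ∈ ys → z ∈ zs → P (g x y z))
All-concatMap³ {P = P} g xs ys zs = mk⇔
  (λ all {x} {y} {_} x∈ y∈ z∈ → All.lookup all
     (∈-concatMap⁺ (λ x → concatMap (λ y → map (g x y) zs) ys) (lose x∈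
       (∈-concatMap⁺ (λ y → map (g x y) zs) (lose y∈ (∈-map⁺ (g x y) z∈))))))
  (λ P-g → All.tabulate λ m →
     let x , x∈ , m′ = find (∈-concatMap⁻ (λ x → concatMap (λ y → map (g x y) zs) ys) {xs = xs} m)
         y , y∈ , m″ = find (∈-concatMap⁻ (λ y → map (g x y) zs) {xs = ys} m′)
         z , z∈ , e = ∈-map⁻ (g x y) m″
     in subst P (sym e) (P-g x∈ y∈ z∈))

data Signs : List PROP → List DForm → Set where
  []    : Signs [] []
  plus  : Signs ps ls → Signs (p ∷ ps) (var p ∷ ls)
  minus : Signs ps ls → Signs (p ∷ ps) (neg (var p) ∷ ls)

∈-literalChoices⁻ : ∀ ps → ls ∈ literalChoices ps → Signs ps ls
∈-literalChoices⁻ [] (here refl) = []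
∈-literalChoices⁻ (p ∷ ps) m with find (∈-concatMap⁻ _ {xs = literalChoices ps} m)
... | _ , m′ , here refl         = plus (∈-literalChoices⁻ ps m′)
... | _ , m′ , there (here refl) = minus (∈-literalChoices⁻ ps m′)

∈-literalChoices⁺ : Signs ps ls → ls ∈ literalChoices ps
∈-literalChoices⁺ []        = here refl
∈-literalChoices⁺ (plus s)  = ∈-concatMap⁺ _ (lose (∈-literalChoices⁺ s) (here refl))
∈-literalChoices⁺ (minus s) = ∈-concatMap⁺ _ (lose (∈-literalChoices⁺ s) (there (here refl)))

module _ {W : SDModel} where

  Signs-agree : Signs ps ls → All (Sat W u) ls → All (Sat W v) ls → AgreeOn ps u v
  Signs-agree [] [] [] = []
  Signs-agree (plus s) (u⊨ ∷ us) (v⊨ ∷ vs) = trans u⊨ (sym v⊨) ∷ Signs-agree s us vs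
  Signs-agree (minus s) (u⊭ ∷ us) (v⊭ ∷ vs) = trans (¬-not u⊭) (sym (¬-not v⊭)) ∷ Signs-agree s us vs

  Signs-respect : Signs ps ls → AgreeOn ps u v → All (Sat W u) ls → All (Sat W v) ls
  Signs-respect [] [] [] = []
  Signs-respect (plus s) (e ∷ es) (u⊨ ∷ us) = trans (sym e) u⊨ ∷ Signs-respect s es us
  Signs-respect (minus s) (e ∷ es) (u⊭ ∷ us) = (λ v⊨ → u⊭ (trans e v⊨)) ∷ Signs-respect s es us

  Signs-of : ∀ u ps → ∃[ ls ] (Signs ps ls × All (Sat W u) ls)
  Signs-of u [] = [] , [] , []
  Signs-of u (p ∷ ps) with Signs-of u ps | u p in up
  ... | ls , s , us | true  = var p ∷ ls , plus s , up ∷ us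
  ... | ls , s , us | false = neg (var p) ∷ ls , minus s , not-¬ up ∷ us

data Cover : Bool → Bool → Set where
  left  : Cover true false
  right : Cover false true
  both  : Cover true true

data Split : Mask → Mask → Mask → Set where
  []  : Split [] [] []
  off : Split χ α β → Split (false ∷ χ) (false ∷ α) (false ∷ β)
  on  : Cover a b → Split χ α β → Split (true ∷ χ) (a ∷ α) (b ∷ β)

∈-SPLIT⁻ : ∀ χ → (α , β) ∈ SPLIT χ → Split χ α β
∈-SPLIT⁻ [] (here refl) = []
∈-SPLIT⁻ (false ∷ χ) m with ∈-map⁻ _ m
... | _ , m′ , refl = off (∈-SPLIT⁻ χ m′)
∈-SPLIT⁻ (true ∷ χ) m with find (∈-concatMap⁻ _ {xs = SPLIT χ} m)
... | _ , m′ , here refl                 = on left (∈-SPLIT⁻ χ m′)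
... | _ , m′ , there (here refl)         = on right (∈-SPLIT⁻ χ m′)
... | _ , m′ , there (there (here refl)) = on both (∈-SPLIT⁻ χ m′)

∈-SPLIT⁺ : Split χ α β → (α , β) ∈ SPLIT χ
∈-SPLIT⁺ []           = here refl
∈-SPLIT⁺ (off s)      = ∈-map⁺ _ (∈-SPLIT⁺ s)
∈-SPLIT⁺ (on left s)  = ∈-concatMap⁺ _ (lose (∈-SPLIT⁺ s) (here refl))
∈-SPLIT⁺ (on right s) = ∈-concatMap⁺ _ (lose (∈-SPLIT⁺ s) (there (here refl)))
∈-SPLIT⁺ (on both s)  = ∈-concatMap⁺ _ (lose (∈-SPLIT⁺ s) (there (there (here refl))))

Split-left : ∀ χ → Split χ χ (map (λ _ → false) χ)
Split-left []          = []
Split-left (false ∷ χ) = off (Split-left χ)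
Split-left (true ∷ χ)  = on left (Split-left χ)

module Classical (lem : ExcludedMiddle 0ℓ) (W : SDModel) where

  Sat-∧ : ∀ φ ψ → Sat W v (φ ∧ᴰ ψ) ⇔ (Sat W v φ × Sat W v ψ)
  Sat-∧ φ ψ = mk⇔
    (λ h → decidable-stable lem (λ ¬φ → h (λ φ _ → ¬φ φ))
         , decidable-stable lem (λ ¬ψ → h (λ _ ψ → ¬ψ ψ)))
    (λ (φ , ψ) φ⇒¬ψ → φ⇒¬ψ φ ψ)

  Sat-⋀ : ∀ φs → Sat W v (⋀ φs) ⇔ All (Sat W v) φs
  Sat-⋀ []           = mk⇔ (λ _ → []) (λ _ ¬p → ¬p)
  Sat-⋀ (φ ∷ [])     = mk⇔ (_∷ []) All.head
  Sat-⋀ (φ ∷ φs@(_ ∷ _)) = mk⇔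
    (λ h → let hφ , hφs = to (Sat-∧ φ (⋀ φs)) h in hφ ∷ to (Sat-⋀ φs) hφs)
    (λ hs → from (Sat-∧ φ (⋀ φs)) (All.head hs , from (Sat-⋀ φs) (All.tail hs)))

  Sat-⋁ : ∀ φs → Sat W v (⋁ φs) ⇔ Any (Sat W v) φs
  Sat-⋁ []           = mk⇔ (λ h → ⊥-elim (h (λ p ¬p → ¬p p))) (λ ())
  Sat-⋁ (φ ∷ [])     = mk⇔ here ([ (λ h → h) , (λ ()) ]′ ∘ Any.toSum)
  Sat-⋁ (φ ∷ φs@(_ ∷ _)) = mk⇔
    (λ h → [ here , there ∘ to (Sat-⋁ φs) ∘ h ]′ (toSum lem))
    (λ h ¬hφ → [ ⊥-elim ∘ ¬hφ , from (Sat-⋁ φs) ]′ (Any.toSum h))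

  Sat-[u] : ∀ {w} φ → W w → Sat W w ([u] φ) ⇔ (∀ v → W v → Sat W v φ)
  Sat-[u] {w} φ Ww = mk⇔
    (λ h v Wv → let hφ , constant = to (Sat-∧ φ (C φ)) h in to (constant w v Ww Wv (lift refl)) hφ)
    (λ H → from (Sat-∧ φ (C φ)) (H w Ww , λ u v Wu Wv _ → mk⇔ (λ _ → H v Wv) (λ _ → H u Wu)))

  Sat-⟨u⟩ : ∀ {w} φ → W w → Sat W w (⟨u⟩ φ) ⇔ (∃[ v ] (W v × Sat W v φ))
  Sat-⟨u⟩ φ Ww = mk⇔
    (λ h → decidable-stable lem λ ∄v → h (from (Sat-[u] (neg φ) Ww) λ v Wv hφ → ∄v (v , Wv , hφ)))
    (λ (v , Wv , hφ) h → to (Sat-[u] (neg φ) Ww) h v Wv hφ)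

  Conj-agree : c ∈ Conj ps → Sat W u c → Sat W v c → AgreeOn ps u v
  Conj-agree {ps = ps} c∈ u⊨ v⊨ with ∈-map⁻ ⋀ c∈
  ... | ls , ls∈ , refl =
    anti-mono (∈-deduplicate⁺ _≟_)
      (Signs-agree (∈-literalChoices⁻ (dedup ps) ls∈) (to (Sat-⋀ ls) u⊨) (to (Sat-⋀ ls) v⊨))

  Conj-respect : c ∈ Conj ps → AgreeOn ps u v → Sat W u c → Sat W v c
  Conj-respect {ps = ps} c∈ u~v u⊨ with ∈-map⁻ ⋀ c∈
  ... | ls , ls∈ , refl =
    from (Sat-⋀ ls) (Signs-respect (∈-literalChoices⁻ (dedup ps) ls∈)
                       (anti-mono (∈-deduplicate⁻ _≟_ ps) u~v) (to (Sat-⋀ ls) u⊨))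

  Conj-cover : ∀ u ps → ∃[ c ] (c ∈ Conj ps × Sat W u c)
  Conj-cover u ps =
    let ls , s , us = Signs-of u (dedup ps)
    in ⋀ ls , ∈-map⁺ ⋀ (∈-literalChoices⁺ s) , from (Sat-⋀ ls) us

  Realised : SDModel → DForm → Set
  Realised T φ = ∃[ v ] (T v × Sat W v φ)

  IndepByTypes : SDModel → List⁺ PROP → List PROP → List⁺ PROP → Set
  IndepByTypes T xs ys zs = ∀ {a b c} → a ∈ Conj (toList xs) → b ∈ Conj ys → c ∈ Conj (toList zs) →
    Realised T (b ∧ᴰ a) → Realised T (b ∧ᴰ c) → Realised T (b ∧ᴰ (a ∧ᴰ c))

  indep⇔types : ∀ xs ys zs → (T ⊩ indep xs ys zs) ⇔ IndepByTypes T xs ys zs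
  indep⇔types {T} xs ys zs = mk⇔ byTypes fromTypes
    where
    byTypes : T ⊩ indep xs ys zs → IndepByTypes T xs ys zs
    byTypes (lift H) {a} {b} {c} a∈ b∈ c∈ (v₁ , Tv₁ , ba₁) (v₂ , Tv₂ , bc₂) =
      let b₁ , a₁ = to (Sat-∧ b a) ba₁
          b₂ , c₂ = to (Sat-∧ b c) bc₂
          v , Tv , v~ys , v~xs , v~zs = H v₁ v₂ Tv₁ Tv₂ (Conj-agree b∈ b₁ b₂)
      in v , Tv , from (Sat-∧ b (a ∧ᴰ c))
           ( Conj-respect b∈ (agree-sym v~ys) b₁
           , from (Sat-∧ a c) ( Conj-respect a∈ (agree-sym v~xs) a₁
                              , Conj-respect c∈ (agree-sym v~zs) c₂))

    fromTypes : IndepByTypes T xs ys zs → T ⊩ indep xs ys zs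
    fromTypes H = lift λ w₁ w₂ Tw₁ Tw₂ w₁~w₂ →
      let a , a∈ , a₁ = Conj-cover w₁ (toList xs)
          b , b∈ , b₁ = Conj-cover w₁ ys
          c , c∈ , c₂ = Conj-cover w₂ (toList zs)
          v , Tv , bac = H a∈ b∈ c∈ (w₁ , Tw₁ , from (Sat-∧ b a) (b₁ , a₁))
                                    (w₂ , Tw₂ , from (Sat-∧ b c) (Conj-respect b∈ w₁~w₂ b₁ , c₂))
          bᵥ , acᵥ = to (Sat-∧ b (a ∧ᴰ c)) bac
          aᵥ , cᵥ = to (Sat-∧ a c) acᵥ
      in v , Tv , Conj-agree b∈ bᵥ b₁ , Conj-agree a∈ aᵥ a₁ , Conj-agree c∈ cᵥ c₂

  Selects : Mask → List DForm → Assignment → Set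
  Selects χ           []       v = ⊥
  Selects []          (c ∷ cs) v = ⊥
  Selects (true ∷ χ)  (c ∷ cs) v = Sat W v c ⊎ Selects χ cs v
  Selects (false ∷ χ) (c ∷ cs) v = Selects χ cs v

  Any-select : ∀ χ cs → Any (Sat W v) (select χ cs) ⇔ Selects χ cs v
  Any-select []          []       = mk⇔ (λ ()) (λ ())
  Any-select []          (c ∷ cs) = mk⇔ (λ ()) (λ ())
  Any-select (true ∷ χ)  []       = mk⇔ (λ ()) (λ ())
  Any-select (false ∷ χ) []       = mk⇔ (λ ()) (λ ())
  Any-select (true ∷ χ)  (c ∷ cs) = mk⇔
    (Sum.map₂ (to (Any-select χ cs)) ∘ Any.toSum)
    (Any.fromSum ∘ Sum.map₂ (from (Any-select χ cs)))
  Any-select (false ∷ χ) (c ∷ cs) = Any-select χ cs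

  Sat-dnf : ∀ cs χ → Sat W v (dnf cs χ) ⇔ Selects χ cs v
  Sat-dnf cs χ = Any-select χ cs ⇔-∘ Sat-⋁ (select χ cs)

  Selects-split : Split χ α β → ∀ cs → Selects χ cs v ⇔ (Selects α cs v ⊎ Selects β cs v)
  Selects-split _ [] = mk⇔ (λ ()) [ (λ ()) , (λ ()) ]
  Selects-split [] (c ∷ cs) = mk⇔ (λ ()) [ (λ ()) , (λ ()) ]
  Selects-split (off s) (c ∷ cs) = Selects-split s cs
  Selects-split {v = v} (on left s) (c ∷ cs) = mk⇔
    [ inj₁ ∘ inj₁ , Sum.map₁ inj₂ ∘ to IH ]
    [ [ inj₁ , inj₂ ∘ from IH ∘ inj₁ ] , inj₂ ∘ from IH ∘ inj₂ ]
    where IH = Selects-split {v = v} s cs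
  Selects-split {v = v} (on right s) (c ∷ cs) = mk⇔
    [ inj₂ ∘ inj₁ , Sum.map₂ inj₂ ∘ to IH ]
    [ inj₂ ∘ from IH ∘ inj₁ , [ inj₁ , inj₂ ∘ from IH ∘ inj₂ ] ]
    where IH = Selects-split {v = v} s cs
  Selects-split {v = v} (on both s) (c ∷ cs) = mk⇔
    [ inj₁ ∘ inj₁ , Sum.map inj₂ inj₂ ∘ to IH ]
    [ [ inj₁ , inj₂ ∘ from IH ∘ inj₁ ] , [ inj₁ , inj₂ ∘ from IH ∘ inj₂ ] ]
    where IH = Selects-split {v = v} s cs

  Selects-all : ∀ cs → Any (Sat W v) cs → Selects (replicate (length cs) true) cs v
  Selects-all (c ∷ cs) (here h)  = inj₁ h
  Selects-all (c ∷ cs) (there h) = inj₂ (Selects-all cs h)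

  module Translation (ps : List PROP) where

    types : List DForm
    types = Conj ps

    Team : Mask → SDModel
    Team χ v = W v × Selects χ types v

    Team-split : Split χ α β → ∀ v → Team χ v ⇔ (Team α v ⊎ Team β v)
    Team-split s v = mk⇔
      (λ (Wv , sel) → Sum.map (Wv ,_) (Wv ,_) (to (Selects-split s types) sel))
      [ (λ (Wv , sel) → Wv , from (Selects-split s types) (inj₁ sel))
      , (λ (Wv , sel) → Wv , from (Selects-split s types) (inj₂ sel)) ]

    W⊆Team-all : ∀ v → W v → Team (replicate (length types) true) v
    W⊆Team-all v Wv = let c , c∈ , hc = Conj-cover v ps in Wv , Selects-all types (lose c∈ hc)

    Sat-[u]-Team : ∀ {w} χ φ → W w →
      Sat W w ([u] (dnf types χ ⇒ φ)) ⇔ (∀ v → Team χ v → Sat W v φ)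
    Sat-[u]-Team χ φ Ww = mk⇔
      (λ h v (Wv , sel) → to (Sat-[u] (dnf types χ ⇒ φ) Ww) h v Wv (from (Sat-dnf types χ) sel))
      (λ H → from (Sat-[u] (dnf types χ ⇒ φ) Ww) λ v Wv hχ → H v (Wv , to (Sat-dnf types χ) hχ))

    infix 30 ◇[_]_
    ◇[_]_ : Mask → DForm → DForm
    ◇[ χ ] φ = ⟨u⟩ (dnf types χ ∧ᴰ φ)

    Sat-◇ : ∀ {w} χ φ → W w → Sat W w (◇[ χ ] φ) ⇔ Realised (Team χ) φ
    Sat-◇ χ φ Ww = mk⇔
      (λ h → let v , Wv , hχφ = to (Sat-⟨u⟩ (dnf types χ ∧ᴰ φ) Ww) h
                 hχ , hφ = to (Sat-∧ (dnf types χ) φ) hχφ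
             in v , (Wv , to (Sat-dnf types χ) hχ) , hφ)
      (λ (v , (Wv , sel) , hφ) → from (Sat-⟨u⟩ (dnf types χ ∧ᴰ φ) Ww)
         (v , Wv , from (Sat-∧ (dnf types χ) φ) (from (Sat-dnf types χ) sel , hφ)))

    Sat-◇-implication : ∀ {w} χ φ ψ θ → W w →
      Sat W w ((◇[ χ ] φ ∧ᴰ ◇[ χ ] ψ) ⇒ ◇[ χ ] θ)
      ⇔ (Realised (Team χ) φ → Realised (Team χ) ψ → Realised (Team χ) θ)
    Sat-◇-implication χ φ ψ θ Ww = mk⇔
      (λ h rφ rψ → to ◇θ (h (from ◇φ∧◇ψ (from ◇φ rφ , from ◇ψ rψ))))
      (λ H hφψ → let hφ , hψ = to ◇φ∧◇ψ hφψ in from ◇θ (H (to ◇φ hφ) (to ◇ψ hψ)))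
      where
      ◇φ = Sat-◇ χ φ Ww
      ◇ψ = Sat-◇ χ ψ Ww
      ◇θ = Sat-◇ χ θ Ww
      ◇φ∧◇ψ = Sat-∧ (◇[ χ ] φ) (◇[ χ ] ψ)

    -- α records which of the types selected by χ are realised by X, up to ps-twins.
    record Represents (X : SDModel) (χ α : Mask) (cs : List DForm) : Set where
      field
        inward  : ∀ u → X u → Selects χ cs u → Selects α cs u
        outward : ∀ v → W v → Selects α cs v → ∃[ u ] (X u × AgreeOn ps u v)
    open Represents

    Marks : SDModel → DForm → Bool → Set
    Marks X c true  = ∀ v → W v → Sat W v c → ∃[ u ] (X u × AgreeOn ps u v)
    Marks X c false = ∀ u → X u → ¬ Sat W u c

    Represents-off : Represents T χ α cs′ → Represents T (false ∷ χ) (false ∷ α) (c ∷ cs′)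
    Represents-off r = record { inward = inward r ; outward = outward r }

    Represents-on : Represents T χ α cs′ → Marks T c a → Represents T (true ∷ χ) (a ∷ α) (c ∷ cs′)
    Represents-on {a = true} r m = record
      { inward  = λ u Tu → Sum.map₂ (inward r u Tu)
      ; outward = λ v Wv → [ m v Wv , outward r v Wv ] }
    Represents-on {a = false} r m = record
      { inward  = λ u Tu → [ ⊥-elim ∘ m u Tu , inward r u Tu ]
      ; outward = outward r }

    Represents⇒twins : (∀ u → T u → Team χ u) → Represents T χ α types →
                       T ≲[ ps ] Team α × Team α ≲[ ps ] T
    Represents⇒twins T⊆ r =
      (λ u Tu → let Wu , sel = T⊆ u Tu in u , (Wu , inward r u Tu sel) , agree-refl) ,
      (λ v (Wv , sel) → let u , Tu , u~v = outward r v Wv sel in u , Tu , agree-sym u~v)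

    realised⇒Marks : c ∈ types → Realised T c → Marks T c true
    realised⇒Marks c∈ (u , Tu , hu) v Wv hv = u , Tu , Conj-agree c∈ hu hv

    unrealised⇒Marks : ¬ Realised T c → Marks T c false
    unrealised⇒Marks ¬r u Tu hu = ¬r (u , Tu , hu)

    -- A type realised in W by neither part of a cover may be assigned to either part.
    mark : ∀ {U V} → c ∈ types → (∀ v → W v → Sat W v c → U v ⊎ V v) →
           ∃₂ λ a b → Cover a b × Marks U c a × Marks V c b
    mark {c} {U} {V} c∈ covered with lem {Realised U c} | lem {Realised V c}
    ... | yes rU | yes rV = true , true , both , realised⇒Marks c∈ rU , realised⇒Marks c∈ rV
    ... | yes rU | no ¬rV = true , false , left , realised⇒Marks c∈ rU , unrealised⇒Marks ¬rV
    ... | no ¬rU | yes rV = false , true , right , unrealised⇒Marks ¬rU , realised⇒Marks c∈ rV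
    ... | no ¬rU | no ¬rV = true , false , left , unused , unrealised⇒Marks ¬rV
      where
      unused : Marks U c true
      unused v Wv hv =
        ⊥-elim ([ (λ Uv → ¬rU (v , Uv , hv)) , (λ Vv → ¬rV (v , Vv , hv)) ] (covered v Wv hv))

    split-for : ∀ {U V} χ cs → cs ⊆ types → (∀ v → W v → Selects χ cs v → U v ⊎ V v) →
                ∃₂ λ α β → Split χ α β × Represents U χ α cs × Represents V χ β cs
    split-for χ [] _ _ =
      χ , _ , Split-left χ , record { inward = λ _ _ () ; outward = λ _ _ () }
                           , record { inward = λ _ _ () ; outward = λ _ _ () }
    split-for [] (c ∷ cs) _ _ =
      [] , [] , [] , record { inward = λ _ _ () ; outward = λ _ _ () }
                   , record { inward = λ _ _ () ; outward = λ _ _ () }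
    split-for (false ∷ χ) (c ∷ cs) sub covered =
      let α , β , s , rU , rV = split-for χ cs (sub ∘ there) covered
      in false ∷ α , false ∷ β , off s , Represents-off rU , Represents-off rV
    split-for (true ∷ χ) (c ∷ cs) sub covered =
      let a , b , k , mU , mV = mark (sub (here refl)) (λ v Wv hc → covered v Wv (inj₁ hc))
          α , β , s , rU , rV = split-for χ cs (sub ∘ there) (λ v Wv sel → covered v Wv (inj₂ sel))
      in a ∷ α , b ∷ β , on k s , Represents-on rU mU , Represents-on rV mV

    t-correct : ∀ ψ → props ψ ⊆ ps → ∀ χ {w} → W w → Sat W w (t types χ ψ) ⇔ (Team χ ⊩ ψ)
    t-correct (atom p) _ χ Ww = mk⇔
      (λ h → lift (to (Sat-[u]-Team χ (var p) Ww) h))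
      (λ (lift H) → from (Sat-[u]-Team χ (var p) Ww) H)
    t-correct (natom p) _ χ Ww = mk⇔
      (λ h → lift λ v Tv → ¬-not (to (Sat-[u]-Team χ (neg (var p)) Ww) h v Tv))
      (λ (lift H) → from (Sat-[u]-Team χ (neg (var p)) Ww) λ v Tv → not-¬ (H v Tv))
    t-correct (indep xs ys zs) _ χ {w} Ww =
      ⇔-sym (indep⇔types xs ys zs) ⇔-∘ (realisations ⇔-∘ (All-concatMap³ closure _ _ _ ⇔-∘ Sat-⋀ _))
      where
      closure : DForm → DForm → DForm → DForm
      closure a b c = (◇[ χ ] (b ∧ᴰ a) ∧ᴰ ◇[ χ ] (b ∧ᴰ c)) ⇒ ◇[ χ ] (b ∧ᴰ (a ∧ᴰ c))
      closure⇔ : ∀ a b c → Sat W w (closure a b c) ⇔ (Realised (Team χ) (b ∧ᴰ a) →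
                   Realised (Team χ) (b ∧ᴰ c) → Realised (Team χ) (b ∧ᴰ (a ∧ᴰ c)))
      closure⇔ a b c = Sat-◇-implication χ (b ∧ᴰ a) (b ∧ᴰ c) (b ∧ᴰ (a ∧ᴰ c)) Ww
      realisations : (∀ {a b c} → a ∈ Conj (toList xs) → b ∈ Conj ys → c ∈ Conj (toList zs) →
                        Sat W w (closure a b c))
                     ⇔ IndepByTypes (Team χ) xs ys zs
      realisations = mk⇔
        (λ h {a} {b} {c} a∈ b∈ c∈ → to (closure⇔ a b c) (h a∈ b∈ c∈))
        (λ H {a} {b} {c} a∈ b∈ c∈ → from (closure⇔ a b c) (H a∈ b∈ c∈))
    t-correct (ψ ∧ᴵ ψ′) sub χ Ww =
      (t-correct ψ (sub ∘ xs⊆xs++ys _ _) χ Ww ×-⇔ t-correct ψ′ (sub ∘ xs⊆ys++xs _ (props ψ)) χ Ww)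
      ⇔-∘ Sat-∧ (t types χ ψ) (t types χ ψ′)
    t-correct (ψ ∨ᴵ ψ′) sub χ {w} Ww = mk⇔ toCover fromCover
      where
      sub₁ : props ψ ⊆ ps
      sub₁ = sub ∘ xs⊆xs++ys _ _
      sub₂ : props ψ′ ⊆ ps
      sub₂ = sub ∘ xs⊆ys++xs _ (props ψ)
      disjunct : Mask × Mask → DForm
      disjunct (α , β) = t types α ψ ∧ᴰ t types β ψ′

      toCover : Sat W w (t types χ (ψ ∨ᴵ ψ′)) → Team χ ⊩ (ψ ∨ᴵ ψ′)
      toCover h =
        let (α , β) , αβ∈ , hαβ = find (Any.map⁻ (to (Sat-⋁ (map disjunct (SPLIT χ))) h))
            hα , hβ = to (Sat-∧ (t types α ψ) (t types β ψ′)) hαβ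
        in Team α , Team β , Team-split (∈-SPLIT⁻ χ αβ∈) ,
           to (t-correct ψ sub₁ α Ww) hα , to (t-correct ψ′ sub₂ β Ww) hβ

      fromCover : Team χ ⊩ (ψ ∨ᴵ ψ′) → Sat W w (t types χ (ψ ∨ᴵ ψ′))
      fromCover (U , V , cover , hU , hV) =
        let α , β , s , rU , rV = split-for χ types (λ c∈ → c∈) (λ v Wv sel → to (cover v) (Wv , sel))
            U≲α , α≲U = Represents⇒twins (λ u Uu → from (cover u) (inj₁ Uu)) rU
            V≲β , β≲V = Represents⇒twins (λ u Vu → from (cover u) (inj₂ Vu)) rV
            hα = from (t-correct ψ sub₁ α Ww) (⊩-transfer ψ sub₁ U≲α α≲U hU)
            hβ = from (t-correct ψ′ sub₂ β Ww) (⊩-transfer ψ′ sub₂ V≲β β≲V hV)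
        in from (Sat-⋁ (map disjunct (SPLIT χ)))
             (Any.map⁺ (lose (∈-SPLIT⁺ s) (from (Sat-∧ (t types α ψ) (t types β ψ′)) (hα , hβ))))

lemma6p3 : ExcludedMiddle 0ℓ → (φ : IForm) (W : SDModel) → (W ⊩ φ) ⇔ (W ⊨ translate φ)
lemma6p3 lem φ W = mk⇔
  (λ W⊩φ w Ww → from (t-correct φ id (χ-full φ) Ww) (⊩-transfer φ id W≲Team Team≲W W⊩φ))
  (λ W⊨tφ → case lem {∃ W} of λ
    { (yes (w , Ww)) → ⊩-transfer φ id Team≲W W≲Team (to (t-correct φ id (χ-full φ) Ww) (W⊨tφ w Ww))
    ; (no ∄w)        → ⊩-empty φ (λ w Ww → ∄w (w , Ww)) })
  where
  open Classical lem W
  open Translation (props φ)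
  W≲Team : W ≲[ props φ ] Team (χ-full φ)
  W≲Team = ≲-reflexive W⊆Team-all
  Team≲W : Team (χ-full φ) ≲[ props φ ] W
  Team≲W = ≲-reflexive (λ _ → proj₁)
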